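{- Let $B$ be the bow-tie. For every $G\in\mathcal{E}_{\{B\}}$ and every finite $A\subseteq V(G)$, $|\mathrm{acl}_G(A)|\le 4|A|$.
   Context: The bow-tie is the graph on five vertices formed by two triangles sharing exactly one vertex. All graphs are simple. $\mathcal{G}_{\{B\}}$ is the class of countable graphs with no subgraph (not necessarily induced) isomorphic to $B$. $G\in\mathcal{G}_{\{B\}}$ is existentially complete if for every $H\in\mathcal{G}_{\{B\}}$ containing $G$ as an induced subgraph, every existential first-order formula (language of adjacency) with parameters from $G$ true in $H$ is true in $G$; $\mathcal{E}_{\{B\}}$ is the class of these. For $G\in\mathcal{E}_{\{B\}}$ and $A\subseteq V(G)$, $\mathrm{acl}_G(A)$ is the set of vertices $a$ for which some existential formula $\phi(x,\bar a)$ with parameters from $A$ has a finite solution set in $G$ containing $a$. -}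

module Defs where

open import Data.Nat using (ℕ; _+_)
open import Data.Fin using (Fin; zero; suc)
open import Data.Product using (Σ; _×_; _,_)
open import Data.Sum using (_⊎_)
open import Data.List using (List; length; lookup)
open import Data.List.Membership.Propositional using (_∈_)
open import Data.Vec.Functional using (Vector; _++_)
open import Relation.Nullary using (¬_)
open import Relation.Binary.PropositionalEquality using (_≡_)
open import Function.Definitions using (Injective)

record Graph : Set₁ where
  field
    V         : Set
    E         : V → V → Set
    E-sym     : ∀ {x y} → E x y → E y x
    E-irrefl  : ∀ x → ¬ E x x
    countable : Σ (V → ℕ) (Injective _≡_ _≡_)

open Graph public

data BowEdge : Fin 5 → Fin 5 → Set where
  e01 : BowEdge zero (suc zero)
  e02 : BowEdge zero (suc (suc zero))
  e12 : BowEdge (suc zero) (suc (suc zero))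
  e03 : BowEdge zero (suc (suc (suc zero)))
  e04 : BowEdge zero (suc (suc (suc (suc zero))))
  e34 : BowEdge (suc (suc (suc zero))) (suc (suc (suc (suc zero))))

HasBowTie : Graph → Set
HasBowTie G =
  Σ (Fin 5 → V G) λ f → Injective _≡_ _≡_ f × (∀ {i j} → BowEdge i j → E G (f i) (f j))

BowTieFree : Graph → Set
BowTieFree G = ¬ HasBowTie G

record InducedEmbedding (G H : Graph) : Set where
  field
    map   : V G → V H
    inj   : Injective _≡_ _≡_ map
    pres  : ∀ {x y} → E G x y → E H (map x) (map y)
    refl′ : ∀ {x y} → E H (map x) (map y) → E G x y

data Term (n : ℕ) (P : Set) : Set where
  var : Fin n → Term n P
  par : P → Term n P

data QF (n : ℕ) (P : Set) : Set where
  adj  : Term n P → Term n P → QF n P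
  eq   : Term n P → Term n P → QF n P
  neg  : QF n P → QF n P
  and  : QF n P → QF n P → QF n P
  or   : QF n P → QF n P → QF n P

-- existential formulas  ∃ y₁ … y_k . ψ(x₁ … x_n, y₁ … y_k)  (prenex form)
record ExFormula (n : ℕ) (P : Set) : Set where
  constructor ∃[_]_
  field
    k    : ℕ
    body : QF (n + k) P

module _ (G : Graph) {P : Set} (π : P → V G) where

  evalT : ∀ {n} → Vector (V G) n → Term n P → V G
  evalT ρ (var i) = ρ i
  evalT ρ (par p) = π p

  SatQF : ∀ {n} → Vector (V G) n → QF n P → Set
  SatQF ρ (adj s t) = E G (evalT ρ s) (evalT ρ t)
  SatQF ρ (eq s t)  = evalT ρ s ≡ evalT ρ t
  SatQF ρ (neg φ)   = ¬ SatQF ρ φ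
  SatQF ρ (and φ ψ) = SatQF ρ φ × SatQF ρ ψ
  SatQF ρ (or φ ψ)  = SatQF ρ φ ⊎ SatQF ρ ψ

  Sat : ∀ {n} → ExFormula n P → Vector (V G) n → Set
  Sat (∃[ k ] ψ) ρ = Σ (Vector (V G) k) λ σ → SatQF (ρ ++ σ) ψ

noVars : ∀ {A : Set} → Vector A 0
noVars ()

ExistentiallyComplete : Graph → Set₁
ExistentiallyComplete G =
  (H : Graph) → BowTieFree H → (e : InducedEmbedding G H) →
  (φ : ExFormula 0 (V G)) →
  Sat H (InducedEmbedding.map e) φ noVars → Sat G (λ v → v) φ noVars

InE-B : Graph → Set₁
InE-B G = BowTieFree G × ExistentiallyComplete G

-- Algebraic closure.  A finite parameter set A is a list; formulas
-- with parameters from A use parameter type Fin (length A).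

single : ∀ {A : Set} → A → Vector A 1
single a _ = a

InAcl : (G : Graph) → List (V G) → V G → Set
InAcl G A a =
  Σ (ExFormula 1 (Fin (length A))) λ φ →
    Sat G (lookup A) φ (single a) ×
    -- the solution set of φ in G is finite
    Σ (List (V G)) λ L → ∀ b → Sat G (lookup A) φ (single b) → b ∈ L

-- Call T ⊆ V(G) closed if every triangle with apex in T has a second vertex in T, and every
-- edge from T to its complement lies in at most one triangle.  In a bow-tie-free graph every
-- vertex a lies in a closed set of at most four vertices: a K4 through a, an edge aw carrying
-- two triangles with non-adjacent third vertices, a triangle through a whose edges at a carry
-- no second triangle, or {a} itself.  Closedness survives unions, so A lies in a closed S with
-- |S| ≤ 4|A|, and it is what keeps the free amalgam of two copies of G over S
-- bow-tie-free.  If v ∉ S were algebraic over A via φ with the finite solution set L, the second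
-- copy of v would solve φ outside L in the amalgam; existential completeness pulls such a
-- solution back to G, contradicting finiteness.  So acl(A) ⊆ S.  The argument is classical; it
-- runs in the double-negation monad, which suffices because the conclusion is decidable.
module Submission where

open import Defs
open import Level using (0ℓ)
open import Data.Nat using (ℕ; zero; suc; _*_; _+_; _≤_; _≤?_; z≤n; s≤s)
open import Data.Nat.Properties
  using (≤-refl; ≤-trans; ≤-reflexive; +-mono-≤; *-suc; *-cancelˡ-≡; even≢odd; suc-injective)
open import Data.Fin using (Fin; zero; suc)
open import Data.Fin.Properties using (injective⇒≤)
open import Data.List using (List; []; _∷_; length; lookup; _++_)
open import Data.List.Properties using (length-++)
open import Data.List.Relation.Unary.All as All using (All; []; _∷_)
open import Data.List.Relation.Unary.All.Properties using (All¬⇒¬Any; ++⁺)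
open import Data.List.Relation.Unary.Any using (here; there; index)
open import Data.List.Relation.Unary.Any.Properties using (lookup-index)
open import Data.List.Relation.Unary.Unique.Propositional using (Unique)
open import Data.List.Relation.Unary.AllPairs using ([]; _∷_)
open import Data.List.Relation.Binary.Subset.Propositional using (_⊆_)
open import Data.List.Membership.Propositional using (_∈_; _∉_)
open import Data.List.Membership.Propositional.Properties using (∈-lookup; ∈-++⁺ˡ; ∈-++⁺ʳ)
open import Data.Vec as Vec using (Vec; []; _∷_)
open import Data.Vec.Relation.Unary.All using ([]; _∷_)
open import Data.Vec.Relation.Unary.AllPairs using ([]; _∷_)
open import Data.Vec.Relation.Unary.Unique.Propositional using () renaming (Unique to VecUnique)
open import Data.Vec.Relation.Unary.Unique.Propositional.Properties using (lookup-injective)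
open import Data.Vec.Functional as Vector using (Vector)
open import Data.Product using (Σ; _×_; _,_; proj₁; proj₂)
open import Data.Product.Function.NonDependent.Propositional using (_×-⇔_)
open import Data.Sum using (_⊎_; inj₁; inj₂; reduce)
open import Data.Sum.Properties using (inj₁-injective; inj₂-injective)
open import Data.Sum.Function.Propositional using (_⊎-⇔_)
open import Data.Empty using (⊥)
open import Effect.Monad using (RawMonad)
open import Function using (_∘_; id; _⇔_; mk⇔; Equivalence)
open import Function.Construct.Identity using (⇔-id)
open import Function.Related.TypeIsomorphisms using (¬-cong-⇔)
open import Function.Definitions using (Injective)
open import Relation.Nullary using (¬_; yes; no; contradiction)
open import Relation.Nullary.Decidable using (decidable-stable; ¬¬-excluded-middle)
open import Relation.Nullary.Negation using (¬¬-Monad)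
open import Relation.Binary.PropositionalEquality
  using (_≡_; _≢_; refl; sym; cong; cong₂; subst; module ≡-Reasoning)

open RawMonad (¬¬-Monad {0ℓ})

unique-lookup-injective : ∀ {X : Set} {xs : List X} → Unique xs → Injective _≡_ _≡_ (lookup xs)
unique-lookup-injective {xs = _ ∷ _} _ {zero} {zero} _ = refl
unique-lookup-injective {xs = _ ∷ _} (x≢xs ∷ _) {zero} {suc j} equal =
  contradiction equal (All.lookup x≢xs (∈-lookup j))
unique-lookup-injective {xs = _ ∷ _} (x≢xs ∷ _) {suc i} {zero} equal =
  contradiction (sym equal) (All.lookup x≢xs (∈-lookup i))
unique-lookup-injective {xs = _ ∷ _} (_ ∷ xs-unique) {suc i} {suc j} equal =
  cong suc (unique-lookup-injective xs-unique equal)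

unique-⊆⇒length≤ : ∀ {X : Set} {xs ys : List X} → Unique xs → All (_∈ ys) xs → length xs ≤ length ys
unique-⊆⇒length≤ {xs = xs} {ys} xs-unique xs⊆ys = injective⇒≤ position-injective
  where
  position : Fin (length xs) → Fin (length ys)
  position i = index (All.lookup xs⊆ys (∈-lookup i))

  position-injective : Injective _≡_ _≡_ position
  position-injective {i} {j} equal = unique-lookup-injective xs-unique (begin
    lookup xs i            ≡⟨ lookup-index (All.lookup xs⊆ys (∈-lookup i)) ⟩
    lookup ys (position i) ≡⟨ cong (lookup ys) equal ⟩
    lookup ys (position j) ≡⟨ lookup-index (All.lookup xs⊆ys (∈-lookup j)) ⟨
    lookup xs j            ∎)
    where open ≡-Reasoning

length-++-≤ : ∀ {X : Set} (xs ys : List X) {m n} → length xs ≤ m → length ys ≤ n → length (xs ++ ys) ≤ m + n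
length-++-≤ xs ys xs≤m ys≤n = subst (_≤ _) (sym (length-++ xs)) (+-mono-≤ xs≤m ys≤n)

¬¬-finite-choice : ∀ {n} {B : Fin n → Set} → (∀ i → ¬ ¬ B i) → ¬ ¬ (∀ i → B i)
¬¬-finite-choice {zero} _ = pure λ ()
¬¬-finite-choice {suc n} ¬¬B = do
  b₀ ← ¬¬B zero
  bs ← ¬¬-finite-choice (¬¬B ∘ suc)
  pure λ where
    zero    → b₀
    (suc i) → bs i

Countable : Set → Set
Countable X = Σ (X → ℕ) (Injective _≡_ _≡_)

countable-⊎ : ∀ {X Y : Set} → Countable X → Countable Y → Countable (X ⊎ Y)
countable-⊎ {X} {Y} (f , f-injective) (g , g-injective) = code , code-injective
  where
  code : X ⊎ Y → ℕ
  code (inj₁ x) = 2 * f x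
  code (inj₂ y) = suc (2 * g y)

  code-injective : Injective _≡_ _≡_ code
  code-injective {inj₁ _} {inj₁ _} equal = cong inj₁ (f-injective (*-cancelˡ-≡ _ _ 2 equal))
  code-injective {inj₁ x} {inj₂ y} equal = contradiction equal (even≢odd (f x) (g y))
  code-injective {inj₂ y} {inj₁ x} equal = contradiction (sym equal) (even≢odd (f x) (g y))
  code-injective {inj₂ _} {inj₂ _} equal = cong inj₂ (g-injective (*-cancelˡ-≡ _ _ 2 (suc-injective equal)))

mapTerm : ∀ {n} {P Q : Set} → (P → Q) → Term n P → Term n Q
mapTerm g (var i) = var i
mapTerm g (par p) = par (g p)

mapQF : ∀ {n} {P Q : Set} → (P → Q) → QF n P → QF n Q
mapQF g (adj s t) = adj (mapTerm g s) (mapTerm g t)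
mapQF g (eq s t)  = eq (mapTerm g s) (mapTerm g t)
mapQF g (neg φ)   = neg (mapQF g φ)
mapQF g (and φ ψ) = and (mapQF g φ) (mapQF g ψ)
mapQF g (or φ ψ)  = or (mapQF g φ) (mapQF g ψ)

module _ (K : Graph) {P Q : Set} (g : P → Q) (π : Q → V K) {n} (ρ : Vector (V K) n) where

  evalT-mapTerm : ∀ t → evalT K π ρ (mapTerm g t) ≡ evalT K (π ∘ g) ρ t
  evalT-mapTerm (var i) = refl
  evalT-mapTerm (par p) = refl

  SatQF-mapQF : ∀ φ → SatQF K π ρ (mapQF g φ) ≡ SatQF K (π ∘ g) ρ φ
  SatQF-mapQF (adj s t) = cong₂ (E K) (evalT-mapTerm s) (evalT-mapTerm t)
  SatQF-mapQF (eq s t)  = cong₂ _≡_ (evalT-mapTerm s) (evalT-mapTerm t)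
  SatQF-mapQF (neg φ)   = cong ¬_ (SatQF-mapQF φ)
  SatQF-mapQF (and φ ψ) = cong₂ _×_ (SatQF-mapQF φ) (SatQF-mapQF ψ)
  SatQF-mapQF (or φ ψ)  = cong₂ _⊎_ (SatQF-mapQF φ) (SatQF-mapQF ψ)

module _ {K K′ : Graph} (R : V K → V K′ → Set)
         (R-adj : ∀ {x y x′ y′} → R x x′ → R y y′ → E K x y ⇔ E K′ x′ y′)
         (R-≡ : ∀ {x y x′ y′} → R x x′ → R y y′ → (x ≡ y) ⇔ (x′ ≡ y′))
         {P : Set} {π : P → V K} {π′ : P → V K′} (R-par : ∀ p → R (π p) (π′ p))
         {n} {ρ : Vector (V K) n} {ρ′ : Vector (V K′) n} (R-var : ∀ i → R (ρ i) (ρ′ i)) where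

  evalT-related : ∀ t → R (evalT K π ρ t) (evalT K′ π′ ρ′ t)
  evalT-related (var i) = R-var i
  evalT-related (par p) = R-par p

  SatQF-transfer : ∀ φ → SatQF K π ρ φ ⇔ SatQF K′ π′ ρ′ φ
  SatQF-transfer (adj s t) = R-adj (evalT-related s) (evalT-related t)
  SatQF-transfer (eq s t)  = R-≡ (evalT-related s) (evalT-related t)
  SatQF-transfer (neg φ)   = ¬-cong-⇔ (SatQF-transfer φ)
  SatQF-transfer (and φ ψ) = SatQF-transfer φ ×-⇔ SatQF-transfer ψ
  SatQF-transfer (or φ ψ)  = SatQF-transfer φ ⊎-⇔ SatQF-transfer ψ

SatQF-pointwise : ∀ (K : Graph) {P : Set} {π : P → V K} {n} {ρ ρ′ : Vector (V K) n} →
                  (∀ i → ρ i ≡ ρ′ i) → ∀ φ → SatQF K π ρ φ ⇔ SatQF K π ρ′ φ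
SatQF-pointwise K ρ≗ρ′ = SatQF-transfer _≡_ ≡-adj ≡-≡ (λ _ → refl) ρ≗ρ′
  where
  ≡-adj : ∀ {x y x′ y′} → x ≡ x′ → y ≡ y′ → E K x y ⇔ E K x′ y′
  ≡-adj refl refl = ⇔-id _

  ≡-≡ : ∀ {x y x′ y′ : V K} → x ≡ x′ → y ≡ y′ → (x ≡ y) ⇔ (x′ ≡ y′)
  ≡-≡ refl refl = ⇔-id _

sat-head : ∀ (K : Graph) {P : Set} {π : P → V K} {k} {σ : Vector (V K) (suc k)} (ψ : QF (suc k) P) →
           SatQF K π σ ψ → Sat K π (∃[ k ] ψ) (single (σ zero))
sat-head K {σ = σ} ψ sat = σ ∘ suc , Equivalence.to (SatQF-pointwise K head∷tail ψ) sat
  where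
  head∷tail : ∀ i → σ i ≡ (single (σ zero) Vector.++ (σ ∘ suc)) i
  head∷tail zero    = refl
  head∷tail (suc i) = refl

-- The formula x₀ ∉ ls; the empty conjunction is written x₀ = x₀.
outside : ∀ {k} {P : Set} → List P → QF (suc k) P
outside []       = eq (var zero) (var zero)
outside (l ∷ ls) = and (neg (eq (var zero) (par l))) (outside ls)

module _ (K : Graph) {P : Set} (π : P → V K) {k} (ρ : Vector (V K) (suc k)) where

  outside-sat : ∀ ls → All (λ l → ρ zero ≢ π l) ls → SatQF K π ρ (outside ls)
  outside-sat []       []          = refl
  outside-sat (l ∷ ls) (ρ₀≢l ∷ ρ₀∉ls) = ρ₀≢l , outside-sat ls ρ₀∉ls

  outside-sound : ∀ ls → SatQF K π ρ (outside ls) → All (λ l → ρ zero ≢ π l) ls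
  outside-sound []       _              = []
  outside-sound (l ∷ ls) (ρ₀≢l , ρ₀∉ls) = ρ₀≢l ∷ outside-sound ls ρ₀∉ls

module _ {G H : Graph} (ec : ExistentiallyComplete G) (H-free : BowTieFree H) (e : InducedEmbedding G H) where
  open InducedEmbedding e using (map)

  ec-avoiding : ∀ {P : Set} {k} (π : P → V G) (ψ : QF (suc k) P) (L : List (V G)) (ρ : Vector (V H) (suc k)) →
                SatQF H (map ∘ π) ρ ψ → All (λ l → ρ zero ≢ map l) L →
                Σ (Vector (V G) (suc k)) λ σ → SatQF G π σ ψ × σ zero ∉ L
  ec-avoiding {k = k} π ψ L ρ ψ[ρ] ρ₀∉L =
    let σ , ψ[σ] , σ₀∉L = ec H H-free e (∃[ suc k ] and (mapQF π ψ) (outside L))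
                            (ρ , subst id (sym (SatQF-mapQF H π map ρ ψ)) ψ[ρ] , outside-sat H map ρ L ρ₀∉L)
    in σ , subst id (SatQF-mapQF G π id σ ψ) ψ[σ] , All¬⇒¬Any (outside-sound G id σ L σ₀∉L)

Triangle : (G : Graph) → V G → V G → V G → Set
Triangle G c u x = E G c u × E G c x × E G u x

adj⇒≢ : ∀ (G : Graph) {x y} → E G x y → x ≢ y
adj⇒≢ G {y = y} xy refl = E-irrefl G y xy

triangle-swap : ∀ (G : Graph) {c u x} → Triangle G c u x → Triangle G c x u
triangle-swap G (cu , cx , ux) = cx , cu , E-sym G ux

data BowTie (G : Graph) : Set where
  bowTie : ∀ {c u x y z} → Triangle G c u x → Triangle G c y z →
           u ≢ y → u ≢ z → x ≢ y → x ≢ z → BowTie G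

BowTie⇒HasBowTie : ∀ {G} → BowTie G → HasBowTie G
BowTie⇒HasBowTie {G} (bowTie {c} {u} {x} {y} {z} (cu , cx , ux) (cy , cz , yz) u≢y u≢z x≢y x≢z) =
  Vec.lookup vertices , (λ {i} {j} → lookup-injective distinct i j) , edge
  where
  vertices : Vec (V G) 5
  vertices = c ∷ u ∷ x ∷ y ∷ z ∷ []

  distinct : VecUnique vertices
  distinct = (adj⇒≢ G cu ∷ adj⇒≢ G cx ∷ adj⇒≢ G cy ∷ adj⇒≢ G cz ∷ [])
           ∷ (adj⇒≢ G ux ∷ u≢y ∷ u≢z ∷ [])
           ∷ (x≢y ∷ x≢z ∷ [])
           ∷ (adj⇒≢ G yz ∷ [])
           ∷ []
           ∷ []

  edge : ∀ {i j} → BowEdge i j → E G (Vec.lookup vertices i) (Vec.lookup vertices j)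
  edge e01 = cu
  edge e02 = cx
  edge e12 = ux
  edge e03 = cy
  edge e04 = cz
  edge e34 = yz

HasBowTie⇒BowTie : ∀ {G} → HasBowTie G → BowTie G
HasBowTie⇒BowTie {G} (f , f-injective , edge) =
  bowTie (edge e01 , edge e02 , edge e12) (edge e03 , edge e04 , edge e34)
         (distinct λ ()) (distinct λ ()) (distinct λ ()) (distinct λ ())
  where
  distinct : ∀ {i j} → i ≢ j → f i ≢ f j
  distinct i≢j = i≢j ∘ f-injective

∉⇒≢ : ∀ {X : Set} {T : List X} {x y} → x ∈ T → y ∉ T → y ≢ x
∉⇒≢ x∈T y∉T refl = y∉T x∈T

record ClosedAt (G : Graph) (T : List (V G)) (c : V G) : Set where
  field
    triangle-meets : ∀ {u x} → Triangle G c u x → u ∉ T → x ∉ T → ⊥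
    outgoing-edge-in-one-triangle : ∀ {u x y} → u ∉ T → Triangle G c u x → Triangle G c u y → x ≢ y → ⊥

Closed : (G : Graph) → List (V G) → Set
Closed G T = All (ClosedAt G T) T

module _ {G : Graph} where

  ClosedAt-mono : ∀ {T T′ c} → T ⊆ T′ → ClosedAt G T c → ClosedAt G T′ c
  ClosedAt-mono T⊆T′ closed = record
    { triangle-meets = λ t u∉T′ x∉T′ → triangle-meets t (u∉T′ ∘ T⊆T′) (x∉T′ ∘ T⊆T′)
    ; outgoing-edge-in-one-triangle = λ u∉T′ → outgoing-edge-in-one-triangle (u∉T′ ∘ T⊆T′)
    }
    where open ClosedAt closed

  Closed-++ : ∀ {T S} → Closed G T → Closed G S → Closed G (T ++ S)
  Closed-++ {T} T-closed S-closed =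
    ++⁺ (All.map (ClosedAt-mono ∈-++⁺ˡ) T-closed) (All.map (ClosedAt-mono (∈-++⁺ʳ T)) S-closed)

  closedAt-confined : ∀ {T c} → (∀ {u x} → Triangle G c u x → u ∉ T → ⊥) → ClosedAt G T c
  closedAt-confined confined = record
    { triangle-meets = λ t u∉T _ → confined t u∉T
    ; outgoing-edge-in-one-triangle = λ u∉T t _ _ → confined t u∉T
    }

  closedAt-through : ∀ {T c w} → w ∈ T → (∀ {u x} → Triangle G c u x → u ≢ w → x ≢ w → ⊥) → ClosedAt G T c
  closedAt-through {w = w} w∈T through = record
    { triangle-meets = λ t u∉T x∉T → through t (∉⇒≢ w∈T u∉T) (∉⇒≢ w∈T x∉T)
    ; outgoing-edge-in-one-triangle = λ {_} {x} u∉T t t′ x≢y → ¬¬-excluded-middle {A = x ≡ w} λ where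
        (yes refl) → through t′ (∉⇒≢ w∈T u∉T) (x≢y ∘ sym)
        (no x≢w)   → through t (∉⇒≢ w∈T u∉T) x≢w
    }

module BowTieFreeGraph {G : Graph} (free : BowTieFree G) where

  no-bowTie : ∀ {c u x y z} → Triangle G c u x → Triangle G c y z → u ≢ y → u ≢ z → x ≢ y → x ≢ z → ⊥
  no-bowTie t t′ u≢y u≢z x≢y x≢z = free (BowTie⇒HasBowTie {G} (bowTie t t′ u≢y u≢z x≢y x≢z))

  other-wing-meets : ∀ {c u x y z} → Triangle G c u x → Triangle G c y z → u ≢ y → u ≢ z → ¬ ¬ (x ≡ y ⊎ x ≡ z)
  other-wing-meets t t′ u≢y u≢z x-misses = no-bowTie t t′ u≢y u≢z (x-misses ∘ inj₁) (x-misses ∘ inj₂)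

  triangle-meets-triangle : ∀ {T c y z u x} → y ∈ T → z ∈ T → Triangle G c y z →
                            Triangle G c u x → u ∉ T → x ∉ T → ⊥
  triangle-meets-triangle y∈T z∈T t-yz t u∉T x∉T =
    no-bowTie t t-yz (∉⇒≢ y∈T u∉T) (∉⇒≢ z∈T u∉T) (∉⇒≢ y∈T x∉T) (∉⇒≢ z∈T x∉T)

  K4-closedAt : ∀ {T p q r s} → q ∈ T → r ∈ T → s ∈ T →
                E G p q → E G p r → E G p s → E G q r → E G q s → E G r s → ClosedAt G T p
  K4-closedAt {q = q} {r} q∈T r∈T s∈T pq pr ps qr qs rs = closedAt-confined λ {u} {x} t u∉T →
    -- x would have to lie in each of {q, r}, {q, s} and {r, s}.
    let u≢q = ∉⇒≢ q∈T u∉T ; u≢r = ∉⇒≢ r∈T u∉T ; u≢s = ∉⇒≢ s∈T u∉T in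
    ¬¬-excluded-middle {A = x ≡ q} λ where
      (yes refl) → no-bowTie t (pr , ps , rs) u≢r u≢s (adj⇒≢ G qr) (adj⇒≢ G qs)
      (no x≢q) → ¬¬-excluded-middle {A = x ≡ r} λ where
        (yes refl) → no-bowTie t (pq , ps , qs) u≢q u≢s (adj⇒≢ G (E-sym G qr)) (adj⇒≢ G rs)
        (no x≢r)   → no-bowTie t (pq , pr , qr) u≢q u≢r x≢q x≢r

  K4-closed : ∀ {a b c d} → E G a b → E G a c → E G a d → E G b c → E G b d → E G c d →
              Closed G (a ∷ b ∷ c ∷ d ∷ [])
  K4-closed {a} {b} {c} {d} ab ac ad bc bd cd =
      K4-closedAt b∈ c∈ d∈ ab ac ad bc bd cd
    ∷ K4-closedAt a∈ c∈ d∈ (E-sym G ab) bc bd ac ad cd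
    ∷ K4-closedAt a∈ b∈ d∈ (E-sym G ac) (E-sym G bc) cd ab ad bd
    ∷ K4-closedAt a∈ b∈ c∈ (E-sym G ad) (E-sym G bd) (E-sym G cd) ab ac bc
    ∷ []
    where
    a∈ : a ∈ a ∷ b ∷ c ∷ d ∷ []
    a∈ = here refl
    b∈ : b ∈ a ∷ b ∷ c ∷ d ∷ []
    b∈ = there (here refl)
    c∈ : c ∈ a ∷ b ∷ c ∷ d ∷ []
    c∈ = there (there (here refl))
    d∈ : d ∈ a ∷ b ∷ c ∷ d ∷ []
    d∈ = there (there (there (here refl)))

  Book : V G → Set
  Book a = Σ (V G) λ w → Σ (V G) λ p → Σ (V G) λ q → Triangle G a w p × Triangle G a w q × p ≢ q

  book-closedAt : ∀ {T a w p q} → w ∈ T → Triangle G a w p → Triangle G a w q → p ≢ q → ¬ E G p q →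
                  ClosedAt G T a
  book-closedAt {p = p} {q} w∈T t-wp t-wq p≢q ¬pq = closedAt-through w∈T λ {u} {x} t@(_ , _ , ux) u≢w x≢w →
    let w≢u = u≢w ∘ sym ; w≢x = x≢w ∘ sym in
    other-wing-meets t-wp t w≢u w≢x λ p-meets → other-wing-meets t-wq t w≢u w≢x λ q-meets →
    both-meet ux p-meets q-meets
    where
    both-meet : ∀ {u x} → E G u x → p ≡ u ⊎ p ≡ x → q ≡ u ⊎ q ≡ x → ⊥
    both-meet _  (inj₁ refl) (inj₁ refl) = p≢q refl
    both-meet ux (inj₁ refl) (inj₂ refl) = ¬pq ux
    both-meet ux (inj₂ refl) (inj₁ refl) = ¬pq (E-sym G ux)
    both-meet _  (inj₂ refl) (inj₂ refl) = p≢q refl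

  book-closed : ∀ {a w p q} → Triangle G a w p → Triangle G a w q → p ≢ q → ¬ E G p q →
                Closed G (a ∷ w ∷ [])
  book-closed t-wp@(aw , ap , wp) t-wq@(_ , aq , wq) p≢q ¬pq =
      book-closedAt (there (here refl)) t-wp t-wq p≢q ¬pq
    ∷ book-closedAt (here refl) (E-sym G aw , wp , ap) (E-sym G aw , wq , aq) p≢q ¬pq
    ∷ []

  unbooked-closedAt : ∀ {T a b c} → b ∈ T → c ∈ T → Triangle G a b c → ¬ Book a → ClosedAt G T a
  unbooked-closedAt b∈T c∈T t-bc ¬book = record
    { triangle-meets = triangle-meets-triangle b∈T c∈T t-bc
    ; outgoing-edge-in-one-triangle = λ _ t t′ x≢y → ¬book (_ , _ , _ , t , t′ , x≢y)
    }

  unbooked-neighbour-closedAt : ∀ {T a b c} → a ∈ T → c ∈ T → Triangle G b a c → ¬ Book a → ClosedAt G T b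
  unbooked-neighbour-closedAt {a = a} {b} {c} a∈T c∈T t-ac@(ba , bc , ac) ¬book = record
    { triangle-meets = triangle-meets-triangle a∈T c∈T t-ac
    ; outgoing-edge-in-one-triangle = λ u∉T t t′ x≢y →
        let u≢a = ∉⇒≢ a∈T u∉T ; u≢c = ∉⇒≢ c∈T u∉T in
        other-wing-meets t t-ac u≢a u≢c λ x-meets → other-wing-meets t′ t-ac u≢a u≢c λ y-meets →
        both-meet u≢c t t′ x≢y x-meets y-meets
    }
    where
    -- ab would lie in the two triangles abu and abc.
    book-at-a : ∀ {u} → u ≢ c → Triangle G b u a → ⊥
    book-at-a {u} u≢c (bu , _ , ua) =
      ¬book (b , u , c , (E-sym G ba , E-sym G ua , bu) , (E-sym G ba , ac , bc) , u≢c)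

    both-meet : ∀ {u x y} → u ≢ c → Triangle G b u x → Triangle G b u y → x ≢ y →
                x ≡ a ⊎ x ≡ c → y ≡ a ⊎ y ≡ c → ⊥
    both-meet u≢c t _  _   (inj₁ refl) _           = book-at-a u≢c t
    both-meet u≢c _ t′ _   (inj₂ _)    (inj₁ refl) = book-at-a u≢c t′
    both-meet _   _ _  x≢y (inj₂ refl) (inj₂ refl) = x≢y refl

  unbooked-triangle-closed : ∀ {a b c} → Triangle G a b c → ¬ Book a → Closed G (a ∷ b ∷ c ∷ [])
  unbooked-triangle-closed t@(ab , ac , bc) ¬book =
      unbooked-closedAt (there (here refl)) (there (there (here refl))) t ¬book
    ∷ unbooked-neighbour-closedAt (here refl) (there (there (here refl))) (E-sym G ab , bc , ac) ¬book
    ∷ unbooked-neighbour-closedAt (here refl) (there (here refl)) (E-sym G ac , E-sym G bc , ab) ¬book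
    ∷ []

  K4At : V G → Set
  K4At a = Σ (V G) λ b → Σ (V G) λ c → Σ (V G) λ d →
           E G a b × E G a c × E G a d × E G b c × E G b d × E G c d

  TriangleAt : V G → Set
  TriangleAt a = Σ (V G) λ u → Σ (V G) λ x → Triangle G a u x

  closed-neighbourhood : (a : V G) → ¬ ¬ (Σ (List (V G)) λ T → length T ≤ 4 × a ∈ T × Closed G T)
  closed-neighbourhood a = do
    no ¬K4 ← ¬¬-excluded-middle {A = K4At a}
      where yes (b , c , d , ab , ac , ad , bc , bd , cd) →
              pure (_ , ≤-refl , here refl , K4-closed ab ac ad bc bd cd)
    no ¬book ← ¬¬-excluded-middle {A = Book a}
      where yes (w , p , q , t-wp@(aw , ap , wp) , t-wq@(_ , aq , wq) , p≢q) →
              pure (_ , s≤s (s≤s z≤n) , here refl ,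
                    book-closed t-wp t-wq p≢q λ pq → ¬K4 (w , p , q , aw , ap , aq , wp , wq , pq))
    no ¬triangle ← ¬¬-excluded-middle {A = TriangleAt a}
      where yes (_ , _ , t) → pure (_ , s≤s (s≤s (s≤s z≤n)) , here refl , unbooked-triangle-closed t ¬book)
    pure (_ , s≤s z≤n , here refl , closedAt-confined (λ t _ → ¬triangle (_ , _ , t)) ∷ [])

  closed-cover : (A : List (V G)) →
                 ¬ ¬ (Σ (List (V G)) λ S → length S ≤ 4 * length A × A ⊆ S × Closed G S)
  closed-cover []      = pure ([] , z≤n , (λ ()) , [])
  closed-cover (a ∷ A) = do
    T , |T|≤4 , a∈T , T-closed ← closed-neighbourhood a
    S , |S|≤4|A| , A⊆S , S-closed ← closed-cover A
    pure ( T ++ S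
         , ≤-trans (length-++-≤ T S |T|≤4 |S|≤4|A|) (≤-reflexive (sym (*-suc 4 (length A))))
         , (λ where (here refl) → ∈-++⁺ˡ a∈T
                    (there x∈A) → ∈-++⁺ʳ T (A⊆S x∈A))
         , Closed-++ T-closed S-closed )

-- The free amalgam of two copies of G over S.  The first copy is inj₁ G; the second copy
-- consists of inj₁ x for x ∈ S and inj₂ x for x ∉ S, while inj₂ x for x ∈ S is an isolated
-- dummy vertex (this keeps the vertex set a plain sum, so that countability is immediate).
module Amalgam (G : Graph) (S : List (V G)) where

  data Adj : V G ⊎ V G → V G ⊎ V G → Set where
    inner   : ∀ {x y} → E G x y → Adj (inj₁ x) (inj₁ y)
    outer   : ∀ {x y} → E G x y → x ∉ S → y ∉ S → Adj (inj₂ x) (inj₂ y)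
    across  : ∀ {x y} → E G x y → x ∈ S → y ∉ S → Adj (inj₁ x) (inj₂ y)
    across′ : ∀ {x y} → E G x y → x ∉ S → y ∈ S → Adj (inj₂ x) (inj₁ y)

  Adj⇒E : ∀ {h h′} → Adj h h′ → E G (reduce h) (reduce h′)
  Adj⇒E (inner xy)        = xy
  Adj⇒E (outer xy _ _)    = xy
  Adj⇒E (across xy _ _)   = xy
  Adj⇒E (across′ xy _ _)  = xy

  Adj-sym : ∀ {h h′} → Adj h h′ → Adj h′ h
  Adj-sym (inner xy)           = inner (E-sym G xy)
  Adj-sym (outer xy x∉S y∉S)   = outer (E-sym G xy) y∉S x∉S
  Adj-sym (across xy x∈S y∉S)  = across′ (E-sym G xy) y∉S x∈S
  Adj-sym (across′ xy x∉S y∈S) = across (E-sym G xy) y∈S x∉S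

  amalgam : Graph
  amalgam = record
    { V         = V G ⊎ V G
    ; E         = Adj
    ; E-sym     = Adj-sym
    ; E-irrefl  = λ h hh → E-irrefl G (reduce h) (Adj⇒E hh)
    ; countable = countable-⊎ (countable G) (countable G)
    }

  embedding : InducedEmbedding G amalgam
  embedding = record
    { map   = inj₁
    ; inj   = inj₁-injective
    ; pres  = inner
    ; refl′ = λ { (inner xy) → xy }
    }

  reduce-triangle : ∀ {h p q} → Triangle amalgam h p q → Triangle G (reduce h) (reduce p) (reduce q)
  reduce-triangle (hp , hq , pq) = Adj⇒E hp , Adj⇒E hq , Adj⇒E pq

  module _ (S-closed : Closed G S) where

    open ClosedAt

    -- A common neighbour of both copies of x is the first copy of some c ∈ S, and x ∉ S; both
    -- triangles then project to triangles over the edge cx, which carries only one.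
    twin-triangles-coincide : ∀ {h x p q} → Triangle amalgam h (inj₁ x) p → Triangle amalgam h (inj₂ x) q →
                           p ≢ q → ⊥
    twin-triangles-coincide (across′ _ _ x∈S , _) (outer _ _ x∉S , _) _ = x∉S x∈S
    twin-triangles-coincide (inner _ , _ , across _ x∈S _) (across _ _ x∉S , _) _ = x∉S x∈S
    twin-triangles-coincide (inner cx , inner cw , inner xw)
                            (across _ c∈S x∉S , inner cw′ , across′ xw′ _ _) p≢q =
      outgoing-edge-in-one-triangle (All.lookup S-closed c∈S) x∉S
        (cx , cw , xw) (cx , cw′ , xw′) (p≢q ∘ cong inj₁)
    twin-triangles-coincide {p = inj₁ w} {inj₂ w′} (inner cx , inner cw , inner xw)
                         (across _ c∈S x∉S , across cw′ _ w′∉S , outer xw′ _ _) _ =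
      ¬¬-excluded-middle {A = w ≡ w′} λ where
        (yes refl) → triangle-meets (All.lookup S-closed c∈S) (cx , cw , xw) x∉S w′∉S
        (no w≢w′)  → outgoing-edge-in-one-triangle (All.lookup S-closed c∈S) x∉S
                       (cx , cw , xw) (cx , cw′ , xw′) w≢w′

    reduce-separates : ∀ {h p q r s} → Triangle amalgam h p q → Triangle amalgam h r s →
                       p ≢ r → q ≢ s → reduce p ≢ reduce r
    reduce-separates {p = inj₁ _} {r = inj₁ _} _ _ p≢r _ x≡y = p≢r (cong inj₁ x≡y)
    reduce-separates {p = inj₂ _} {r = inj₂ _} _ _ p≢r _ x≡y = p≢r (cong inj₂ x≡y)
    reduce-separates {p = inj₁ _} {r = inj₂ _} t t′ _ q≢s refl = twin-triangles-coincide t t′ q≢s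
    reduce-separates {p = inj₂ _} {r = inj₁ _} t t′ _ q≢s refl = twin-triangles-coincide t′ t (q≢s ∘ sym)

    reduce-bowTie : BowTie amalgam → BowTie G
    reduce-bowTie (bowTie t t′ u≢y u≢z x≢y x≢z) =
      bowTie (reduce-triangle t) (reduce-triangle t′)
             (reduce-separates t t′ u≢y x≢z)
             (reduce-separates t (triangle-swap amalgam t′) u≢z x≢y)
             (reduce-separates (triangle-swap amalgam t) t′ x≢y u≢z)
             (reduce-separates (triangle-swap amalgam t) (triangle-swap amalgam t′) x≢z u≢y)

    amalgam-bowTieFree : BowTieFree G → BowTieFree amalgam
    amalgam-bowTieFree G-free = G-free ∘ BowTie⇒HasBowTie ∘ reduce-bowTie ∘ HasBowTie⇒BowTie

  -- The second embedding of G into the amalgam, as a relation: it is not a function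
  -- because membership in S need not be decidable.
  data SecondCopy (x : V G) : V G ⊎ V G → Set where
    shared : x ∈ S → SecondCopy x (inj₁ x)
    fresh  : x ∉ S → SecondCopy x (inj₂ x)

  SecondCopy-adj : ∀ {x y h h′} → SecondCopy x h → SecondCopy y h′ → E G x y ⇔ Adj h h′
  SecondCopy-adj (shared _)   (shared _)   = mk⇔ inner Adj⇒E
  SecondCopy-adj (shared x∈S) (fresh y∉S)  = mk⇔ (λ xy → across xy x∈S y∉S) Adj⇒E
  SecondCopy-adj (fresh x∉S)  (shared y∈S) = mk⇔ (λ xy → across′ xy x∉S y∈S) Adj⇒E
  SecondCopy-adj (fresh x∉S)  (fresh y∉S)  = mk⇔ (λ xy → outer xy x∉S y∉S) Adj⇒E

  SecondCopy-≡ : ∀ {x y h h′} → SecondCopy x h → SecondCopy y h′ → (x ≡ y) ⇔ (h ≡ h′)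
  SecondCopy-≡ (shared _)   (shared _)   = mk⇔ (cong inj₁) inj₁-injective
  SecondCopy-≡ (fresh _)    (fresh _)    = mk⇔ (cong inj₂) inj₂-injective
  SecondCopy-≡ (shared x∈S) (fresh y∉S)  = mk⇔ (λ { refl → contradiction x∈S y∉S }) λ ()
  SecondCopy-≡ (fresh x∉S)  (shared y∈S) = mk⇔ (λ { refl → contradiction y∈S x∉S }) λ ()

  fresh-copy≢first : ∀ {x h y} → x ∉ S → SecondCopy x h → h ≢ inj₁ y
  fresh-copy≢first x∉S (shared x∈S) = contradiction x∈S x∉S
  fresh-copy≢first x∉S (fresh _)    = λ ()

  ¬¬-secondCopy : ∀ {n} (ρ : Vector (V G) n) →
                  ¬ ¬ (Σ (Vector (V G ⊎ V G) n) λ ρ′ → ∀ i → SecondCopy (ρ i) (ρ′ i))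
  ¬¬-secondCopy ρ = do
    copies ← ¬¬-finite-choice (copy ∘ ρ)
    pure (proj₁ ∘ copies , proj₂ ∘ copies)
    where
    copy : ∀ x → ¬ ¬ Σ (V G ⊎ V G) (SecondCopy x)
    copy x = (λ where (yes x∈S) → _ , shared x∈S
                      (no x∉S)  → _ , fresh x∉S) <$> ¬¬-excluded-middle

module _ {G : Graph} (G-free : BowTieFree G) (ec : ExistentiallyComplete G)
         {A S : List (V G)} (A⊆S : A ⊆ S) (S-closed : Closed G S) where
  open Amalgam G S

  acl⊆closed : ∀ {v} → InAcl G A v → ¬ ¬ v ∈ S
  acl⊆closed {v} ((∃[ k ] ψ) , (σ , ψ[v,σ]) , solutions , complete) v∉S =
    ¬¬-secondCopy (single v Vector.++ σ) λ (ρ , copies) →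
      let ψ[ρ] = Equivalence.to (SatQF-transfer SecondCopy SecondCopy-adj SecondCopy-≡
                                   (λ p → shared (A⊆S (∈-lookup p))) copies ψ) ψ[v,σ]
          ρ₀∉solutions = All.universal (λ _ → fresh-copy≢first v∉S (copies zero)) solutions
          τ , ψ[τ] , τ₀∉solutions = ec-avoiding ec (amalgam-bowTieFree S-closed G-free) embedding
                                      (lookup A) ψ solutions ρ ψ[ρ] ρ₀∉solutions
      in τ₀∉solutions (complete (τ zero) (sat-head G ψ ψ[τ]))

proposition1 : (G : Graph) → InE-B G →
    (A : List (V G)) → Unique A →
    (L : List (V G)) → Unique L → All (InAcl G A) L →
    length L ≤ 4 * length A
proposition1 G (G-free , ec) A _ L L-unique L⊆acl = decidable-stable (length L ≤? 4 * length A) do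
  S , |S|≤4|A| , A⊆S , S-closed ← closed-cover A
  L⊆S ← All.mapM 0ℓ ¬¬-Monad (acl⊆closed G-free ec A⊆S S-closed) L⊆acl
  pure (≤-trans (unique-⊆⇒length≤ L-unique L⊆S) |S|≤4|A|)
  where open BowTieFreeGraph {G} G-free
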